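{- For any positive integers $r\geq 2$ and $n_1,\dots,n_r$, the complete $r$-partite graph $K_{n_1,\dots,n_r}$ is cyclically interval colorable and $w_c(K_{n_1,\dots,n_r})\leq\sum_{i=1}^r n_i$.
   Context: $K_{n_1,\dots,n_r}$ is the simple graph whose vertex set is partitioned into independent sets $V_1,\dots,V_r$ with $|V_i|=n_i$, and in which every vertex of $V_i$ is adjacent to every vertex of $V_j$ for all $i\neq j$. A proper $t$-edge coloring of $G$ is a map $\alpha:E(G)\to\{1,\dots,t\}$ with $\alpha(e)\neq\alpha(e')$ for adjacent edges $e,e'$; $S(v,\alpha)$ is the set of colors on edges incident to $v$. A proper $t$-edge coloring $\alpha$ is a cyclic interval $t$-coloring if for every vertex $v$, either $S(v,\alpha)$ or $\{1,\dots,t\}\setminus S(v,\alpha)$ is a set of consecutive integers. A graph is cyclically interval colorable if it has a cyclic interval $t$-coloring for some positive integer $t$, and then $w_c(G)$ denotes the least such $t$. -}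

module Defs where

open import Data.Nat using (ℕ; _≤_; _<_)
open import Data.Fin using (Fin)
open import Data.Product using (Σ; ∃; ∃-syntax; _×_)
open import Data.Sum using (_⊎_)
open import Data.List using (tabulate)
open import Data.Nat.ListAction using (sum)
open import Function.Bundles using (_⇔_)
open import Relation.Nullary using (¬_)
open import Relation.Binary.PropositionalEquality using (_≡_; _≢_)
open import Level using (0ℓ; suc)

record Graph : Set₁ where
  field
    V      : Set
    Adj    : V → V → Set
    Adj-sym  : ∀ {u v} → Adj u v → Adj v u
    Adj-irr  : ∀ {v} → ¬ Adj v v
open Graph public

Kpart : (r : ℕ) → (Fin r → ℕ) → Graph
Kpart r n = record
  { V = Σ (Fin r) (λ i → Fin (n i))
  ; Adj = λ u v → ¬ (Data.Product.proj₁ u ≡ Data.Product.proj₁ v)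
  ; Adj-sym = λ p q → p (Relation.Binary.PropositionalEquality.sym q)
  ; Adj-irr = λ p → p Relation.Binary.PropositionalEquality.refl
  }

-- An edge coloring is given as a function on ordered vertex pairs that is
-- symmetric on edges (so it is a function on unordered edges uv); its values
-- on non-adjacent pairs are irrelevant.
S : (G : Graph) → (V G → V G → ℕ) → V G → ℕ → Set
S G α v c = ∃[ u ] (Adj G v u × α v u ≡ c)

Consecutive : (ℕ → Set) → Set
Consecutive P = ∃[ a ] ∃[ b ] (∀ x → P x ⇔ (a ≤ x × x ≤ b))

CompIn : ℕ → (ℕ → Set) → ℕ → Set
CompIn t P x = (1 ≤ x × x ≤ t) × ¬ P x

IsProperEdgeColoring : (G : Graph) → ℕ → (V G → V G → ℕ) → Set
IsProperEdgeColoring G t α =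
  (∀ u v → Adj G u v → α u v ≡ α v u) ×
  (∀ u v → Adj G u v → 1 ≤ α u v × α u v ≤ t) ×
  (∀ v u w → Adj G v u → Adj G v w → u ≢ w → α v u ≢ α v w)

IsCyclicIntervalColoring : (G : Graph) → ℕ → (V G → V G → ℕ) → Set
IsCyclicIntervalColoring G t α =
  IsProperEdgeColoring G t α ×
  (∀ v → Consecutive (S G α v) ⊎ Consecutive (CompIn t (S G α v)))

HasCyclicIntervalColoring : Graph → ℕ → Set
HasCyclicIntervalColoring G t = ∃[ α ] IsCyclicIntervalColoring G t α

sumFin : (r : ℕ) → (Fin r → ℕ) → ℕ
sumFin r n = sum (tabulate n)

-- List the vertices part by part at positions 0, …, N − 1 (N = Σ nᵢ), so that
-- each part occupies an interval of positions, and colour the edge uw with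
-- 1 + ((pos u + pos w) mod N).  Seen from a vertex v at position P the colour
-- of uw is the rotation y ↦ y mod N applied to the window P + pos u ∈ [P, P + N),
-- a bijection onto [0, N): so the colouring is proper, and the colours missing
-- at v are the image of the interval of positions of v's own part.  A rotated
-- interval is either an interval or wraps around N, and in the second case the
-- colours present at v form an interval.
module Submission where

open import Defs
open import Data.Nat using (ℕ; zero; suc; _+_; _∸_; _≤_; _<_; _≤?_; _<?_; z≤n; s≤s; NonZero; >-nonZero)
open import Data.Nat.Properties
open import Data.Nat.DivMod using (_%_; m%n<n; m<n⇒m%n≡m; m≤n⇒[n∸m]%m≡n%m; [m+n]%n≡m%n)
open import Data.Fin using (Fin; zero; suc; toℕ; fromℕ<)
open import Data.Fin.Properties using (toℕ<n; toℕ-injective; toℕ-fromℕ<)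
open import Data.Product using (∃-syntax; _×_; _,_; proj₁; proj₂)
open import Data.Sum using (_⊎_; inj₁; inj₂)
import Data.Sum as Sum
open import Data.Sum.Function.Propositional using (_⊎-⇔_)
open import Function.Base using (_∘_)
open import Function.Bundles using (_⇔_; mk⇔; Equivalence)
import Function.Properties.Equivalence as ⇔
open import Level using (0ℓ)
open import Relation.Nullary using (yes; no; contradiction)
open import Relation.Nullary.Decidable using (_×-dec_)
open import Relation.Unary using (Pred; _∩_; _∪_; ∁; _⊆_; Decidable)
open import Relation.Binary.PropositionalEquality using (_≡_; _≢_; refl; sym; trans; cong; subst; subst₂; module ≡-Reasoning)

Ico : ℕ → ℕ → Pred ℕ 0ℓ
Ico a b y = a ≤ y × y < b

Icc : ℕ → ℕ → Pred ℕ 0ℓ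
Icc a b x = a ≤ x × x ≤ b

Ico-+ˡ : ∀ m {a b q} → Ico (m + a) (m + b) (m + q) ⇔ Ico a b q
Ico-+ˡ m = mk⇔ (λ (l , h) → +-cancelˡ-≤ m _ _ l , +-cancelˡ-< m _ _ h)
               (λ (l , h) → +-monoʳ-≤ m l , +-monoʳ-< m h)

Icc-adjacent-∪ : ∀ {a b c} → a ≤ suc b → b ≤ c → ∀ x → (Icc a b x ⊎ Icc (suc b) c x) ⇔ Icc a c x
Icc-adjacent-∪ {a} {b} {c} a≤1+b b≤c x = mk⇔ to from
  where
  to : Icc a b x ⊎ Icc (suc b) c x → Icc a c x
  to (inj₁ (a≤x , x≤b)) = a≤x , ≤-trans x≤b b≤c
  to (inj₂ (b<x , x≤c)) = ≤-trans a≤1+b b<x , x≤c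
  from : Icc a c x → Icc a b x ⊎ Icc (suc b) c x
  from (a≤x , x≤c) with x ≤? b
  ... | yes x≤b = inj₁ (a≤x , x≤b)
  ... | no  x≰b = inj₂ (≰⇒> x≰b , x≤c)

Consecutive-cong : ∀ {A B : Pred ℕ 0ℓ} → (∀ x → A x ⇔ B x) → Consecutive B → Consecutive A
Consecutive-cong A⇔B (a , b , B⇔Icc) = a , b , λ x → ⇔.trans (A⇔B x) (B⇔Icc x)

CompIn-cong : ∀ {A B : Pred ℕ 0ℓ} t → (∀ x → A x ⇔ B x) → ∀ x → CompIn t A x ⇔ CompIn t B x
CompIn-cong t A⇔B x = mk⇔ (λ (range , x∉A) → range , x∉A ∘ Equivalence.from (A⇔B x))
                          (λ (range , x∉B) → range , x∉B ∘ Equivalence.to (A⇔B x))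

module Residues (N : ℕ) .{{_ : NonZero N}} where

  Img : Pred ℕ 0ℓ → Pred ℕ 0ℓ
  Img Y x = ∃[ y ] (Y y × suc (y % N) ≡ x)

  Img-range : ∀ y → Icc 1 N (suc (y % N))
  Img-range y = s≤s z≤n , m%n<n y N

  Img-cong : ∀ {Y Z : Pred ℕ 0ℓ} → (∀ y → Y y ⇔ Z y) → ∀ x → Img Y x ⇔ Img Z x
  Img-cong Y⇔Z x = mk⇔ (λ (y , y∈Y , eq) → y , Equivalence.to (Y⇔Z y) y∈Y , eq)
                       (λ (y , y∈Z , eq) → y , Equivalence.from (Y⇔Z y) y∈Z , eq)

  Img-∪ : ∀ (Y Z : Pred ℕ 0ℓ) x → Img (Y ∪ Z) x ⇔ (Img Y x ⊎ Img Z x)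
  Img-∪ Y Z x = mk⇔ to from
    where
    to : Img (Y ∪ Z) x → Img Y x ⊎ Img Z x
    to (y , inj₁ y∈Y , eq) = inj₁ (y , y∈Y , eq)
    to (y , inj₂ y∈Z , eq) = inj₂ (y , y∈Z , eq)
    from : Img Y x ⊎ Img Z x → Img (Y ∪ Z) x
    from (inj₁ (y , y∈Y , eq)) = y , inj₁ y∈Y , eq
    from (inj₂ (y , y∈Z , eq)) = y , inj₂ y∈Z , eq

  Img-Ico : ∀ {c lo hi} → c ≤ lo → lo ≤ hi → (∀ {y} → Ico lo hi y → y % N ≡ y ∸ c) →
            ∀ x → Img (Ico lo hi) x ⇔ Icc (suc (lo ∸ c)) (hi ∸ c) x
  Img-Ico {c} {lo} {hi} c≤lo lo≤hi reduce x = mk⇔ (to x) (from x)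
    where
    to : ∀ x → Img (Ico lo hi) x → Icc (suc (lo ∸ c)) (hi ∸ c) x
    to _ (y , y∈@(lo≤y , y<hi) , refl) rewrite reduce y∈ =
      s≤s (∸-monoˡ-≤ c lo≤y) , ∸-monoˡ-< y<hi (≤-trans c≤lo lo≤y)
    from : ∀ x → Icc (suc (lo ∸ c)) (hi ∸ c) x → Img (Ico lo hi) x
    from (suc z) (s≤s lo∸c≤z , z<hi∸c) = z + c , z+c∈ , cong suc (trans (reduce z+c∈) (m+n∸n≡m z c))
      where
      z+c∈ : Ico lo hi (z + c)
      z+c∈ = subst (_≤ z + c) (m∸n+n≡m c≤lo) (+-monoˡ-≤ c lo∸c≤z)
           , subst (z + c <_) (m∸n+n≡m (≤-trans c≤lo lo≤hi)) (+-monoˡ-< c z<hi∸c)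

  %-wrap : ∀ {y} → N ≤ y → y < N + N → y % N ≡ y ∸ N
  %-wrap {y} N≤y y<2N = trans (sym (m≤n⇒[n∸m]%m≡n%m N≤y)) (m<n⇒m%n≡m (m<n+o⇒m∸n<o y N y<2N))

  module Window {P : ℕ} (P<N : P < N) where

    W : Pred ℕ 0ℓ
    W = Ico P (P + N)

    W⇒<2N : ∀ {y} → W y → y < N + N
    W⇒<2N (_ , y<P+N) = <-≤-trans y<P+N (+-monoˡ-≤ N (<⇒≤ P<N))

    %-window : ∀ {y} → W y → (y % N ≡ y) ⊎ (N ≤ y × y % N ≡ y ∸ N)
    %-window {y} y∈W with y <? N
    ... | yes y<N = inj₁ (m<n⇒m%n≡m y<N)
    ... | no  y≮N = inj₂ (≮⇒≥ y≮N , %-wrap (≮⇒≥ y≮N) (W⇒<2N y∈W))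

    wrapped<P : ∀ {y} → W y → N ≤ y → y ∸ N < P
    wrapped<P {y} (_ , y<P+N) N≤y = subst (y ∸ N <_) (m+n∸n≡m P N) (∸-monoˡ-< y<P+N N≤y)

    unwrapped≢wrapped : ∀ {y₁ y₂} → W y₁ → W y₂ → N ≤ y₂ → y₁ ≢ y₂ ∸ N
    unwrapped≢wrapped (P≤y₁ , _) y₂∈W N≤y₂ eq = <⇒≱ (wrapped<P y₂∈W N≤y₂) (subst (P ≤_) eq P≤y₁)

    %-injective : ∀ {y₁ y₂} → W y₁ → W y₂ → y₁ % N ≡ y₂ % N → y₁ ≡ y₂
    %-injective w₁ w₂ eq with %-window w₁ | %-window w₂
    ... | inj₁ e₁ | inj₁ e₂ = trans (sym e₁) (trans eq e₂)
    ... | inj₂ (N≤y₁ , e₁) | inj₂ (N≤y₂ , e₂) = ∸-cancelʳ-≡ N≤y₁ N≤y₂ (trans (sym e₁) (trans eq e₂))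
    ... | inj₁ e₁ | inj₂ (N≤y₂ , e₂) =
      contradiction (trans (sym e₁) (trans eq e₂)) (unwrapped≢wrapped w₁ w₂ N≤y₂)
    ... | inj₂ (N≤y₁ , e₁) | inj₁ e₂ =
      contradiction (trans (sym e₂) (trans (sym eq) e₁)) (unwrapped≢wrapped w₂ w₁ N≤y₁)

    %-onto : ∀ {x} → x < N → ∃[ y ] (W y × y % N ≡ x)
    %-onto {x} x<N with P ≤? x
    ... | yes P≤x = x , (P≤x , <-≤-trans x<N (m≤n+m N P)) , m<n⇒m%n≡m x<N
    ... | no  P≰x = x + N , (≤-trans (<⇒≤ P<N) (m≤n+m N x) , +-monoˡ-< N (≰⇒> P≰x))
                  , trans ([m+n]%n≡m%n x N) (m<n⇒m%n≡m x<N)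

    Img-∁ : (B : Pred ℕ 0ℓ) → Decidable B → B ⊆ W → ∀ x → CompIn N (Img (W ∩ ∁ B)) x ⇔ Img B x
    Img-∁ B B? B⊆W x = mk⇔ (to x) (from x)
      where
      to : ∀ x → CompIn N (Img (W ∩ ∁ B)) x → Img B x
      to (suc z) ((_ , z<N) , x∉) with %-onto z<N
      ... | y , y∈W , eq with B? y
      ...   | yes y∈B = y , y∈B , cong suc eq
      ...   | no  y∉B = contradiction (y , (y∈W , y∉B) , cong suc eq) x∉
      from : ∀ x → Img B x → CompIn N (Img (W ∩ ∁ B)) x
      from _ (y , y∈B , refl) = Img-range y , λ (y′ , (y′∈W , y′∉B) , eq) →
        y′∉B (subst B (%-injective (B⊆W y∈B) y′∈W (sym (suc-injective eq))) y∈B)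

    Img-∁-Ico : ∀ {b e} → P ≤ b → e ≤ P + N → ∀ x → CompIn N (Img (W ∩ ∁ (Ico b e))) x ⇔ Img (Ico b e) x
    Img-∁-Ico {b} {e} P≤b e≤P+N = Img-∁ (Ico b e) (λ y → b ≤? y ×-dec y <? e)
      (λ (b≤y , y<e) → ≤-trans P≤b b≤y , <-≤-trans y<e e≤P+N)

    W∖Ico : ∀ {b e} → P ≤ b → b ≤ e → e ≤ P + N → ∀ y → (W ∩ ∁ (Ico b e)) y ⇔ (Ico e (P + N) ∪ Ico P b) y
    W∖Ico {b} {e} P≤b b≤e e≤P+N y = mk⇔ to from
      where
      to : (W ∩ ∁ (Ico b e)) y → (Ico e (P + N) ∪ Ico P b) y
      to ((P≤y , y<P+N) , y∉) with y <? b | y <? e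
      ... | yes y<b | _       = inj₂ (P≤y , y<b)
      ... | no  y≮b | yes y<e = contradiction (≮⇒≥ y≮b , y<e) y∉
      ... | no  _   | no  y≮e = inj₁ (≮⇒≥ y≮e , y<P+N)
      from : (Ico e (P + N) ∪ Ico P b) y → (W ∩ ∁ (Ico b e)) y
      from (inj₁ (e≤y , y<P+N)) = (≤-trans (≤-trans P≤b b≤e) e≤y , y<P+N) , λ (_ , y<e) → <⇒≱ y<e e≤y
      from (inj₂ (P≤y , y<b))   = (P≤y , <-≤-trans y<b (≤-trans b≤e e≤P+N)) , λ (b≤y , _) → <⇒≱ y<b b≤y

    -- Either [b, e) does not straddle N, and its image is an interval, or it
    -- does, and then the image of the rest of the window is the interval (e − N, b].
    Img-W∖Ico-cyclic : ∀ {b e} → P ≤ b → b ≤ e → e ≤ P + N →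
      Consecutive (Img (W ∩ ∁ (Ico b e))) ⊎ Consecutive (CompIn N (Img (W ∩ ∁ (Ico b e))))
    Img-W∖Ico-cyclic {b} {e} P≤b b≤e e≤P+N with e ≤? N | N ≤? b
    ... | yes e≤N | _ = inj₂ (Consecutive-cong (Img-∁-Ico P≤b e≤P+N) (_ , _ ,
          Img-Ico z≤n b≤e (λ (_ , y<e) → m<n⇒m%n≡m (<-≤-trans y<e e≤N))))
    ... | no _ | yes N≤b = inj₂ (Consecutive-cong (Img-∁-Ico P≤b e≤P+N) (_ , _ ,
          Img-Ico N≤b b≤e (λ (b≤y , y<e) →
            %-wrap (≤-trans N≤b b≤y) (W⇒<2N (≤-trans P≤b b≤y , <-≤-trans y<e e≤P+N)))))
    ... | no e≰N | no N≰b = inj₁ (_ , _ , λ x →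
          ⇔.trans (Img-cong (W∖Ico P≤b b≤e e≤P+N) x)
         (⇔.trans (Img-∪ _ _ x)
         (⇔.trans (upper x ⊎-⇔ lower x)
                  (Icc-adjacent-∪ (s≤s (m≤n+o⇒m∸n≤o e N (subst (e ≤_) (+-comm P N) e≤P+N))) P≤b x))))
      where
      N<e : N < e
      N<e = ≰⇒> e≰N
      upper : ∀ x → Img (Ico e (P + N)) x ⇔ Icc (suc (e ∸ N)) P x
      upper = subst (λ h → ∀ x → Img (Ico e (P + N)) x ⇔ Icc (suc (e ∸ N)) h x) (m+n∸n≡m P N)
        (Img-Ico (<⇒≤ N<e) e≤P+N (λ (e≤y , y<P+N) →
          %-wrap (<⇒≤ (<-≤-trans N<e e≤y)) (W⇒<2N (≤-trans (≤-trans P≤b b≤e) e≤y , y<P+N))))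
      lower : ∀ x → Img (Ico P b) x ⇔ Icc (suc P) b x
      lower = Img-Ico z≤n P≤b (λ (_ , y<b) → m<n⇒m%n≡m (<-trans y<b (≰⇒> N≰b)))

offset : ∀ r → (Fin r → ℕ) → Fin r → ℕ
offset (suc r) n zero    = 0
offset (suc r) n (suc i) = n zero + offset r (n ∘ suc) i

position : ∀ r (n : Fin r → ℕ) → V (Kpart r n) → ℕ
position r n (i , j) = offset r n i + toℕ j

block : ∀ r → (Fin r → ℕ) → Fin r → Pred ℕ 0ℓ
block r n i = Ico (offset r n i) (offset r n i + n i)

offset+size≤sum : ∀ r (n : Fin r → ℕ) i → offset r n i + n i ≤ sumFin r n
offset+size≤sum (suc r) n zero    = m≤m+n (n zero) _
offset+size≤sum (suc r) n (suc i) =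
  subst (_≤ sumFin (suc r) n) (sym (+-assoc (n zero) _ _))
    (+-monoʳ-≤ (n zero) (offset+size≤sum r (n ∘ suc) i))

position∈block : ∀ r (n : Fin r → ℕ) i (j : Fin (n i)) → block r n i (position r n (i , j))
position∈block r n i j = m≤m+n _ _ , +-monoʳ-< (offset r n i) (toℕ<n j)

position<sum : ∀ r (n : Fin r → ℕ) u → position r n u < sumFin r n
position<sum r n (i , j) = <-≤-trans (proj₂ (position∈block r n i j)) (offset+size≤sum r n i)

position∈block⇒≡ : ∀ r (n : Fin r → ℕ) k (j : Fin (n k)) i → block r n i (position r n (k , j)) → k ≡ i
position∈block⇒≡ (suc r) n zero    j zero    _ = refl
position∈block⇒≡ (suc r) n zero    j (suc i) (lo , _) =
  contradiction (≤-trans (m≤m+n (n zero) _) lo) (<⇒≱ (toℕ<n j))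
position∈block⇒≡ (suc r) n (suc k) j zero    (_ , hi) =
  contradiction (≤-trans (m≤m+n (n zero) _) (≤-reflexive (sym (+-assoc (n zero) _ (toℕ j))))) (<⇒≱ hi)
position∈block⇒≡ (suc r) n (suc k) j (suc i) (lo , hi) =
  cong suc (position∈block⇒≡ r (n ∘ suc) k j i (Equivalence.to (Ico-+ˡ (n zero))
    (subst (n zero + offset r (n ∘ suc) i ≤_) (+-assoc (n zero) _ (toℕ j)) lo ,
     subst₂ _<_ (+-assoc (n zero) _ (toℕ j)) (+-assoc (n zero) _ (n (suc i))) hi)))

position-injective : ∀ r (n : Fin r → ℕ) u w → position r n u ≡ position r n w → u ≡ w
position-injective r n (k , j) (i , j′) eq
  with refl ← position∈block⇒≡ r n k j i (subst (block r n i) (sym eq) (position∈block r n i j′))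
  = cong (k ,_) (toℕ-injective (+-cancelˡ-≡ (offset r n k) _ _ eq))

position-onto : ∀ r (n : Fin r → ℕ) q → q < sumFin r n → ∃[ u ] position r n u ≡ q
position-onto (suc r) n q q<sum with q <? n zero
... | yes q<n₀ = (zero , fromℕ< q<n₀) , toℕ-fromℕ< q<n₀
... | no  q≮n₀ with position-onto r (n ∘ suc) (q ∸ n zero)
                      (subst (q ∸ n zero <_) (m+n∸m≡n (n zero) _) (∸-monoˡ-< q<sum (≮⇒≥ q≮n₀)))
...   | (k , j) , eq = (suc k , j) , (begin
          n zero + offset r (n ∘ suc) k + toℕ j   ≡⟨ +-assoc (n zero) _ (toℕ j) ⟩
          n zero + position r (n ∘ suc) (k , j)   ≡⟨ cong (n zero +_) eq ⟩
          n zero + (q ∸ n zero)                   ≡⟨ m+[n∸m]≡n (≮⇒≥ q≮n₀) ⟩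
          q                                       ∎)
  where open ≡-Reasoning

module CyclicColouring (r : ℕ) (n : Fin r → ℕ) .{{_ : NonZero (sumFin r n)}} where

  open Residues (sumFin r n)

  N : ℕ
  N = sumFin r n

  G : Graph
  G = Kpart r n

  pos : V G → ℕ
  pos = position r n

  colouring : V G → V G → ℕ
  colouring u w = suc ((pos u + pos w) % N)

  module _ (v : V G) where
    open Window (position<sum r n v)

    pos-window : ∀ u → W (pos v + pos u)
    pos-window u = m≤m+n (pos v) _ , +-monoʳ-< (pos v) (position<sum r n u)

    window-pos : ∀ {y} → W y → ∃[ u ] pos v + pos u ≡ y
    window-pos {y} (P≤y , y<P+N) with position-onto r n (y ∸ pos v) (m<n+o⇒m∸n<o y (pos v) y<P+N)
    ... | u , eq = u , trans (cong (pos v +_) eq) (m+[n∸m]≡n P≤y)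

    colouring-injective : ∀ u w → colouring v u ≡ colouring v w → u ≡ w
    colouring-injective u w eq = position-injective r n u w
      (+-cancelˡ-≡ (pos v) _ _ (%-injective (pos-window u) (pos-window w) (suc-injective eq)))

    own-part : Pred ℕ 0ℓ
    own-part = Ico (pos v + offset r n (proj₁ v)) (pos v + (offset r n (proj₁ v) + n (proj₁ v)))

    colours-at : ∀ x → S G colouring v x ⇔ Img (W ∩ ∁ own-part) x
    colours-at x = mk⇔ to from
      where
      to : S G colouring v x → Img (W ∩ ∁ own-part) x
      to ((k , j) , adj , eq) = pos v + pos (k , j) , (pos-window (k , j) , adj ∘ sym ∘ same-part) , eq
        where
        same-part : own-part (pos v + pos (k , j)) → k ≡ proj₁ v
        same-part = position∈block⇒≡ r n k j (proj₁ v) ∘ Equivalence.to (Ico-+ˡ (pos v))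
      from : Img (W ∩ ∁ own-part) x → S G colouring v x
      from (y , (y∈W , y∉own) , eq) with window-pos y∈W
      ... | (k , j) , refl = (k , j) , adj , eq
        where
        adj : proj₁ v ≢ k
        adj refl = y∉own (Equivalence.from (Ico-+ˡ (pos v)) (position∈block r n k j))

    cyclic-at : Consecutive (S G colouring v) ⊎ Consecutive (CompIn N (S G colouring v))
    cyclic-at = Sum.map (Consecutive-cong colours-at) (Consecutive-cong (CompIn-cong N colours-at))
      (Img-W∖Ico-cyclic (m≤m+n (pos v) _) (+-monoʳ-≤ (pos v) (m≤m+n _ _))
        (+-monoʳ-≤ (pos v) (offset+size≤sum r n (proj₁ v))))

  colouring-proper : IsProperEdgeColoring G N colouring
  colouring-proper = (λ u w _ → cong (λ y → suc (y % N)) (+-comm (pos u) (pos w)))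
                   , (λ u w _ → Img-range (pos u + pos w))
                   , λ v u w _ _ u≢w eq → u≢w (colouring-injective v u w eq)

  colouring-cyclic : IsCyclicIntervalColoring G N colouring
  colouring-cyclic = colouring-proper , cyclic-at

corollary8 : (r : ℕ) → 2 ≤ r → (n : Fin r → ℕ) → (∀ i → 1 ≤ n i) →
    ∃[ t ] (1 ≤ t × t ≤ sumFin r n × HasCyclicIntervalColoring (Kpart r n) t)
corollary8 zero () n 1≤n
corollary8 (suc r) _ n 1≤n = sumFin (suc r) n , 1≤N , ≤-refl , colouring , colouring-cyclic
  where
  1≤N : 1 ≤ sumFin (suc r) n
  1≤N = ≤-trans (1≤n zero) (m≤m+n (n zero) _)
  open CyclicColouring (suc r) n {{>-nonZero 1≤N}} using (colouring; colouring-cyclic)
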